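{- Fix a $k$-partition with sinks $\{\hat P,\hat Y\}$. Let $s^*\in\mathcal S$ be a worst-case scenario for $\{\hat P,\hat Y\}$ with dominant part $P_d$. Let $s'$ be the scenario with $w_i(s')=w_i(s^*)$ for $x_i\in P_d$ and $w_i(s')=w_i^-$ for $x_i\notin P_d$. Then $s'$ is also a worst-case scenario for $\{\hat P,\hat Y\}$.
   Context: $P$ is a path with vertices at coordinates $x_0<\dots<x_n$; $\tau>0$. Vertex $x_i$ has weight interval $[w_i^-,w_i^+]$, $0<w_i^-\le w_i^+$; a scenario $s$ assigns $w_i(s)\in[w_i^-,w_i^+]$, and $\mathcal S$ is the set of scenarios. For a subpath $Q=\{x_l,\dots,x_r\}$, sink $y=x_t\in Q$: $\Theta_L(Q,y,s)=\max_{l\le i<t}\{(x_t-x_i)\tau+\sum_{j=l}^i w_j(s)\}$, $\Theta_R(Q,y,s)=\max_{t<i\le r}\{(x_i-x_t)\tau+\sum_{j=i}^r w_j(s)\}$ (empty maxima $0$), $\Theta^1(Q,y,s)=\max(\Theta_L,\Theta_R)$. A $k$-partition with sinks $\{\hat P,\hat Y\}$: consecutive subpaths $P_1,\dots,P_k$ (left to right) partitioning the vertices, sinks $y_i$ vertices of $P_i$. $\Theta^k(P,\{\hat P,\hat Y\},s)=\max_i\Theta^1(P_i,y_i,s)$; $\Theta^k_{\rm opt}(P,s)$ its minimum over all $k$-partitions with sinks. Regret $R(\{\hat P,\hat Y\},s)=\Theta^k-\Theta^k_{\rm opt}$; a worst-case scenario for $\{\hat P,\hat Y\}$ is a scenario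 maximizing the regret over $\mathcal S$. The dominant part under $s$ is $P_d$ where $d$ is the smallest index maximizing $\Theta^1(P_i,y_i,s)$.
   Formalization: The coordinates $x_i$, the parameter τ, the weight bounds $w_i^-,w_i^+$ and all scenarios, including those over which the regret is maximized, are rational. -}

module Defs where

open import Data.Nat as ℕ using (ℕ; zero; suc; _∸_)
import Data.Nat.Properties as ℕP
open import Data.Bool using (Bool; true; false; if_then_else_; _∧_)
open import Data.List using (List; map; foldr; upTo)
open import Data.Product using (Σ; _×_; _,_; ∃)
open import Data.Rational using (ℚ; 0ℚ; _+_; _-_; _*_; _⊔_; _≤_; _<_)
open import Relation.Binary.PropositionalEquality using (_≡_)

record Instance : Set where
  field
    n   : ℕ
    x   : ℕ → ℚ
    τ   : ℚ
    w⁻  : ℕ → ℚ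
    w⁺  : ℕ → ℚ
    x-incr  : ∀ i → i ℕ.< n → x i < x (suc i)
    τ-pos   : 0ℚ < τ
    w⁻-pos  : ∀ i → i ℕ.≤ n → 0ℚ < w⁻ i
    w⁻≤w⁺   : ∀ i → i ℕ.≤ n → w⁻ i ≤ w⁺ i
open Instance public

-- A scenario assigns w i ∈ [w⁻ i, w⁺ i] to each vertex i ≤ n
-- (values at indices > n are irrelevant and never used).
Scenario : Instance → Set
Scenario I = ℕ → ℚ

IsScenario : (I : Instance) → Scenario I → Set
IsScenario I s = ∀ i → i ℕ.≤ n I → (w⁻ I i ≤ s i) × (s i ≤ w⁺ I i)

range : ℕ → ℕ → List ℕ
range a b = map (a ℕ.+_) (upTo (b ∸ a))

maxℚ : List ℚ → ℚ
maxℚ = foldr _⊔_ 0ℚ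

sumW : (ℕ → ℚ) → ℕ → ℕ → ℚ
sumW s a b = foldr _+_ 0ℚ (map s (range a (suc b)))

-- Subpath {x_l,...,x_r}, sink x_t.
ΘL : (I : Instance) → ℕ → ℕ → Scenario I → ℚ
ΘL I l t s = maxℚ (map (λ i → ((x I t - x I i) * τ I) + sumW s l i) (range l t))

ΘR : (I : Instance) → ℕ → ℕ → Scenario I → ℚ
ΘR I r t s = maxℚ (map (λ i → ((x I i - x I t) * τ I) + sumW s i r) (range (suc t) (suc r)))

Θ¹ : (I : Instance) → ℕ → ℕ → ℕ → Scenario I → ℚ
Θ¹ I l r t s = ΘL I l t s ⊔ ΘR I r t s

-- A k-partition with sinks: boundaries b 0 = 0 < b 1 < ... < b k = n+1;
-- part i (i < k) is {x_{b i}, ..., x_{b (i+1) - 1}}, with sink x_{y i}.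
record Partition (I : Instance) (k : ℕ) : Set where
  field
    b      : ℕ → ℕ
    y      : ℕ → ℕ
    b-zero : b 0 ≡ 0
    b-last : b k ≡ suc (n I)
    b-incr : ∀ i → i ℕ.< k → b i ℕ.< b (suc i)
    y-lo   : ∀ i → i ℕ.< k → b i ℕ.≤ y i
    y-hi   : ∀ i → i ℕ.< k → y i ℕ.< b (suc i)
open Partition public

ΘPart : (I : Instance) {k : ℕ} → Partition I k → ℕ → Scenario I → ℚ
ΘPart I P i s = Θ¹ I (b P i) (b P (suc i) ∸ 1) (y P i) s

Θk : (I : Instance) (k : ℕ) → Partition I k → Scenario I → ℚ
Θk I k P s = maxℚ (map (λ i → ΘPart I P i s) (upTo k))

IsOpt : (I : Instance) (k : ℕ) → Scenario I → ℚ → Set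
IsOpt I k s v = (Σ (Partition I k) λ Q → Θk I k Q s ≡ v)
              × (∀ (Q : Partition I k) → v ≤ Θk I k Q s)

IsRegret : (I : Instance) (k : ℕ) → Partition I k → Scenario I → ℚ → Set
IsRegret I k P s r = Σ ℚ λ v → IsOpt I k s v × (r ≡ Θk I k P s - v)

IsWorstCase : (I : Instance) (k : ℕ) → Partition I k → Scenario I → Set
IsWorstCase I k P s* =
  IsScenario I s* ×
  (∀ (s : Scenario I) → IsScenario I s →
     ∀ v v* → IsOpt I k s v → IsOpt I k s* v* →
     (Θk I k P s - v) ≤ (Θk I k P s* - v*))

IsDominant : (I : Instance) (k : ℕ) → Partition I k → Scenario I → ℕ → Set
IsDominant I k P s d =
  (d ℕ.< k) ×
  (∀ i → i ℕ.< k → ΘPart I P i s ≤ ΘPart I P d s) ×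
  (∀ i → i ℕ.< d → ΘPart I P i s < ΘPart I P d s)

restrictTo : (I : Instance) {k : ℕ} → Partition I k → ℕ → Scenario I → Scenario I
restrictTo I P d s i =
  if (b P d ℕ.≤ᵇ i) ∧ (i ℕ.<ᵇ b P (suc d)) then s i else w⁻ I i

{-# OPTIONS --safe #-}
-- On the dominant part the scenario s' coincides with s*, and under s* that part attains
-- Θᵏ(P, s*); hence Θᵏ(P, s') ≥ Θᵏ(P, s*). Everywhere else s' only lowers weights, and every
-- Θ¹ is monotone in the weights, so Θᵏ_opt(s') ≤ Θᵏ_opt(s*). The regret of s' is therefore at
-- least that of s*, which is maximal. Regrets are phrased through optimal values, so we also
-- need that Θᵏ_opt(s*) exists: up to the values of b and y that Θᵏ never reads, there are only
-- finitely many k-partitions, and one of them minimises Θᵏ.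
module Submission where

open import Defs
open import Data.Nat using (ℕ)

open import Algebra.Core using (Op₂)
open import Data.Bool using (true; false; _∧_)
open import Data.Bool.Properties using (T-∧; T-≡)
open import Data.List using (List; []; _∷_; [_]; map; foldr; upTo; cartesianProduct; cartesianProductWith)
import Data.List.Extrema
open import Data.List.Membership.Propositional using (_∈_)
open import Data.List.Membership.Propositional.Properties
  using (∈-map⁺; ∈-applyUpTo⁺; ∈-cartesianProduct⁺; ∈-cartesianProductWith⁺)
open import Data.List.Properties using (map-cong-local)
open import Data.List.Relation.Unary.All as All using (All; []; _∷_)
import Data.List.Relation.Unary.All.Properties as All
open import Data.List.Relation.Unary.Any using (here; there)
open import Data.Nat as ℕ using (zero; suc; _∸_)
import Data.Nat.Properties as ℕP
open import Data.Product using (∃; _×_; _,_; proj₁; proj₂)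
open import Data.Rational using (ℚ; 0ℚ; _-_; _*_; _≤_)
import Data.Rational.Properties as ℚP
open import Function using (id; const; _∘_; Equivalence)
open import Relation.Binary using (_Preserves₂_⟶_⟶_; DecTotalOrder)
open import Relation.Binary.PropositionalEquality using (_≡_; refl; sym; trans; cong; cong-app; subst₂)
open import Relation.Nullary using (Dec; yes; no; contradiction)
open import Relation.Nullary.Decidable using (_×-dec_)

open Data.List.Extrema (DecTotalOrder.totalOrder ℚP.≤-decTotalOrder) using (argmin; f[argmin]≤f[xs])

foldr-map-mono : ∀ {A : Set} {_∙_ : Op₂ ℚ} → _∙_ Preserves₂ _≤_ ⟶ _≤_ ⟶ _≤_ →
                 ∀ e {xs : List A} {f g : A → ℚ} → All (λ a → f a ≤ g a) xs →
                 foldr _∙_ e (map f xs) ≤ foldr _∙_ e (map g xs)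
foldr-map-mono ∙-mono e []             = ℚP.≤-refl
foldr-map-mono ∙-mono e (fa≤ga ∷ rest) = ∙-mono fa≤ga (foldr-map-mono ∙-mono e rest)

maxℚ-map-mono : ∀ {A : Set} {xs : List A} {f g : A → ℚ} → All (λ a → f a ≤ g a) xs →
                maxℚ (map f xs) ≤ maxℚ (map g xs)
maxℚ-map-mono = foldr-map-mono ℚP.⊔-mono-≤ 0ℚ

0≤maxℚ : ∀ {A : Set} (f : A → ℚ) xs → 0ℚ ≤ maxℚ (map f xs)
0≤maxℚ f []       = ℚP.≤-refl
0≤maxℚ f (x ∷ xs) = ℚP.p≤q⇒p≤r⊔q (f x) (0≤maxℚ f xs)

∈⇒≤maxℚ : ∀ {x xs} → x ∈ xs → x ≤ maxℚ xs
∈⇒≤maxℚ                (here refl)  = ℚP.p≤p⊔q _ _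
∈⇒≤maxℚ {xs = y ∷ _}  (there x∈xs) = ℚP.p≤q⇒p≤r⊔q y (∈⇒≤maxℚ x∈xs)

maxℚ≤ : ∀ {r xs} → 0ℚ ≤ r → All (_≤ r) xs → maxℚ xs ≤ r
maxℚ≤ 0≤r []           = 0≤r
maxℚ≤ 0≤r (x≤r ∷ xs≤r) = ℚP.⊔-lub x≤r (maxℚ≤ 0≤r xs≤r)

minimiser : ∀ {A : Set} (cost : A → ℚ) (a₀ : A) (xs : List A) →
            (∀ a → ∃ λ a' → a' ∈ xs × cost a' ≤ cost a) → ∃ λ m → ∀ a → cost m ≤ cost a
minimiser cost a₀ xs covered = argmin cost a₀ xs , argmin-minimal
  where
  argmin-minimal : ∀ a → cost (argmin cost a₀ xs) ≤ cost a
  argmin-minimal a with covered a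
  ... | a' , a'∈xs , a'≤a = ℚP.≤-trans (All.lookup (f[argmin]≤f[xs] a₀ xs) a'∈xs) a'≤a

m<o∸n⇒n+m<o : ∀ n {m o} → m ℕ.< o ∸ n → n ℕ.+ m ℕ.< o
m<o∸n⇒n+m<o zero    m<o                = m<o
m<o∸n⇒n+m<o (suc n) {o = zero}  ()
m<o∸n⇒n+m<o (suc n) {o = suc o} m<o∸n = ℕ.s≤s (m<o∸n⇒n+m<o n m<o∸n)

All-range⁺ : ∀ {P : ℕ → Set} a c → (∀ {j} → a ℕ.≤ j → j ℕ.< c → P j) → All P (range a c)
All-range⁺ a c p = All.map⁺ (All.applyUpTo⁺₁ id (c ∸ a) λ {u} u<c∸a →
  p (ℕP.m≤m+n a u) (m<o∸n⇒n+m<o a u<c∸a))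

module _ (I : Instance) {s s' : Scenario I} where

  sumW-mono : ∀ a c → (∀ {j} → a ℕ.≤ j → j ℕ.≤ c → s j ≤ s' j) → sumW s a c ≤ sumW s' a c
  sumW-mono a c s≤s' = foldr-map-mono ℚP.+-mono-≤ 0ℚ
    (All-range⁺ a (suc c) λ a≤j j<1+c → s≤s' a≤j (ℕP.m<1+n⇒m≤n j<1+c))

  ΘL-mono : ∀ l t → (∀ {j} → l ℕ.≤ j → j ℕ.< t → s j ≤ s' j) → ΘL I l t s ≤ ΘL I l t s'
  ΘL-mono l t s≤s' = maxℚ-map-mono (All-range⁺ l t λ {i} l≤i i<t →
    ℚP.+-monoʳ-≤ ((x I t - x I i) * τ I) (sumW-mono l i λ l≤j j≤i → s≤s' l≤j (ℕP.≤-<-trans j≤i i<t)))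

  ΘR-mono : ∀ r t → (∀ {j} → t ℕ.< j → j ℕ.≤ r → s j ≤ s' j) → ΘR I r t s ≤ ΘR I r t s'
  ΘR-mono r t s≤s' = maxℚ-map-mono (All-range⁺ (suc t) (suc r) λ {i} t<i _ →
    ℚP.+-monoʳ-≤ ((x I i - x I t) * τ I) (sumW-mono i r λ i≤j j≤r → s≤s' (ℕP.≤-trans t<i i≤j) j≤r))

  Θ¹-mono : ∀ {l r t} → l ℕ.≤ t → t ℕ.≤ r → (∀ {j} → l ℕ.≤ j → j ℕ.≤ r → s j ≤ s' j) →
            Θ¹ I l r t s ≤ Θ¹ I l r t s'
  Θ¹-mono {l} {r} {t} l≤t t≤r s≤s' = ℚP.⊔-mono-≤
    (ΘL-mono l t λ l≤j j<t → s≤s' l≤j (ℕP.≤-trans (ℕP.<⇒≤ j<t) t≤r))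
    (ΘR-mono r t λ t<j j≤r → s≤s' (ℕP.≤-trans l≤t (ℕP.<⇒≤ t<j)) j≤r)

0≤Θ¹ : ∀ I l r t (s : Scenario I) → 0ℚ ≤ Θ¹ I l r t s
0≤Θ¹ I l r t s = ℚP.≤-trans (0≤maxℚ _ (range l t)) (ℚP.p≤p⊔q (ΘL I l t s) (ΘR I r t s))

increasing⇒≤ : ∀ (f : ℕ → ℕ) {i k} → (∀ j → j ℕ.< k → f j ℕ.< f (suc j)) → i ℕ.≤′ k → f i ℕ.≤ f k
increasing⇒≤ f inc ℕ.≤′-refl          = ℕP.≤-refl
increasing⇒≤ f inc (ℕ.≤′-step i≤′k) =
  ℕP.≤-trans (increasing⇒≤ f (λ j → inc j ∘ ℕP.m<n⇒m<1+n) i≤′k) (ℕP.<⇒≤ (inc _ ℕP.≤-refl))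

module _ {I : Instance} {k : ℕ} (Q : Partition I k) where

  InPart : ℕ → ℕ → Set
  InPart i j = b Q i ℕ.≤ j × j ℕ.< b Q (suc i)

  b≤1+n : ∀ {i} → i ℕ.≤ k → b Q i ℕ.≤ suc (n I)
  b≤1+n i≤k = ℕP.≤-trans (increasing⇒≤ (b Q) (b-incr Q) (ℕP.≤⇒≤′ i≤k)) (ℕP.≤-reflexive (b-last Q))

  b∈upTo : ∀ {i} → i ℕ.≤ k → b Q i ∈ upTo (suc (suc (n I)))
  b∈upTo i≤k = ∈-applyUpTo⁺ id (ℕ.s≤s (b≤1+n i≤k))

  y∈upTo : ∀ {i} → i ℕ.< k → y Q i ∈ upTo (suc (suc (n I)))
  y∈upTo i<k = ∈-applyUpTo⁺ id (ℕP.m<n⇒m<1+n (ℕP.<-≤-trans (y-hi Q _ i<k) (b≤1+n i<k)))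

  InPart⇒≤n : ∀ {i j} → i ℕ.< k → InPart i j → j ℕ.≤ n I
  InPart⇒≤n i<k (_ , j<b) = ℕP.m<1+n⇒m≤n (ℕP.<-≤-trans j<b (b≤1+n i<k))

  ΘPart-mono : ∀ {i} {s s' : Scenario I} → i ℕ.< k → (∀ {j} → InPart i j → s j ≤ s' j) →
               ΘPart I Q i s ≤ ΘPart I Q i s'
  ΘPart-mono {i} i<k s≤s' = Θ¹-mono I (y-lo Q i i<k) (ℕP.<⇒≤pred (y-hi Q i i<k))
    λ b≤j j≤r → s≤s' (b≤j , ℕP.m≤pred[n]⇒suc[m]≤n {{b-nonZero}} j≤r)
    where
    b-nonZero : ℕ.NonZero (b Q (suc i))
    b-nonZero = ℕ.>-nonZero (ℕP.≤-<-trans ℕ.z≤n (y-hi Q i i<k))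

  Θk-mono : ∀ {s s' : Scenario I} → (∀ {j} → j ℕ.≤ n I → s j ≤ s' j) → Θk I k Q s ≤ Θk I k Q s'
  Θk-mono s≤s' = maxℚ-map-mono (All.applyUpTo⁺₁ id k λ i<k → ΘPart-mono i<k (s≤s' ∘ InPart⇒≤n i<k))

  ΘPart≤Θk : ∀ {i} {s : Scenario I} → i ℕ.< k → ΘPart I Q i s ≤ Θk I k Q s
  ΘPart≤Θk i<k = ∈⇒≤maxℚ (∈-map⁺ _ (∈-applyUpTo⁺ id i<k))

  Θk≡ΘPart-dominant : ∀ {s : Scenario I} {d} → IsDominant I k Q s d → Θk I k Q s ≡ ΘPart I Q d s
  Θk≡ΘPart-dominant {s} {d} (d<k , dominates , _) = ℚP.≤-antisym
    (maxℚ≤ (0≤Θ¹ I (b Q d) (b Q (suc d) ∸ 1) (y Q d) s)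
           (All.map⁺ (All.applyUpTo⁺₁ id k (dominates _))))
    (ΘPart≤Θk d<k)

module _ {I : Instance} {k : ℕ} (P : Partition I k) (d : ℕ) (s : Scenario I) where

  restrictTo-on-part : ∀ {j} → InPart P d j → restrictTo I P d s j ≡ s j
  restrictTo-on-part {j} (b≤j , j<b)
    rewrite Equivalence.to T-≡ (Equivalence.from T-∧ (ℕP.≤⇒≤ᵇ b≤j , ℕP.<⇒<ᵇ j<b)) = refl

  restrictTo-≤ : IsScenario I s → ∀ {j} → j ℕ.≤ n I → restrictTo I P d s j ≤ s j
  restrictTo-≤ s-ok {j} j≤n with (b P d ℕ.≤ᵇ j) ∧ (j ℕ.<ᵇ b P (suc d))
  ... | true  = ℚP.≤-refl
  ... | false = proj₁ (s-ok j j≤n)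

  restrictTo-isScenario : IsScenario I s → IsScenario I (restrictTo I P d s)
  restrictTo-isScenario s-ok j j≤n with (b P d ℕ.≤ᵇ j) ∧ (j ℕ.<ᵇ b P (suc d))
  ... | true  = s-ok j j≤n
  ... | false = ℚP.≤-refl , w⁻≤w⁺ I j j≤n

module _ {A : Set} where

  EqualBelow : ℕ → (ℕ → A) → (ℕ → A) → Set
  EqualBelow m f g = ∀ {i} → i ℕ.< m → f i ≡ g i

  _∷ˢ_ : A → (ℕ → A) → ℕ → A
  (a ∷ˢ f) zero    = a
  (a ∷ˢ f) (suc i) = f i

  sequencesOver : A → List A → ℕ → List (ℕ → A)
  sequencesOver a₀ L zero    = [ const a₀ ]
  sequencesOver a₀ L (suc m) = cartesianProductWith _∷ˢ_ L (sequencesOver a₀ L m)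

  sequencesOver-complete : ∀ a₀ L m (f : ℕ → A) → (∀ {i} → i ℕ.< m → f i ∈ L) →
                           ∃ λ g → g ∈ sequencesOver a₀ L m × EqualBelow m f g
  sequencesOver-complete a₀ L zero    f _   = const a₀ , here refl , λ ()
  sequencesOver-complete a₀ L (suc m) f f∈L with sequencesOver-complete a₀ L m (f ∘ suc) (f∈L ∘ ℕ.s≤s)
  ... | g , g∈ , f≗g = f 0 ∷ˢ g , ∈-cartesianProductWith⁺ _∷ˢ_ (f∈L ℕ.z<s) g∈ , f≗f₀∷g
    where
    f≗f₀∷g : EqualBelow (suc m) f (f 0 ∷ˢ g)
    f≗f₀∷g {zero}  _           = refl
    f≗f₀∷g {suc i} (ℕ.s≤s i<m) = f≗g i<m

module _ (I : Instance) (k : ℕ) where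

  IsPartition : (ℕ → ℕ) → (ℕ → ℕ) → Set
  IsPartition β η = β 0 ≡ 0 × β k ≡ suc (n I)
                  × (∀ {i} → i ℕ.< k → β i ℕ.< β (suc i))
                  × (∀ {i} → i ℕ.< k → β i ℕ.≤ η i)
                  × (∀ {i} → i ℕ.< k → η i ℕ.< β (suc i))

  isPartition? : ∀ β η → Dec (IsPartition β η)
  isPartition? β η = β 0 ℕ.≟ 0
              ×-dec β k ℕ.≟ suc (n I)
              ×-dec ℕP.allUpTo? (λ i → β i ℕ.<? β (suc i)) k
              ×-dec ℕP.allUpTo? (λ i → β i ℕ.≤? η i) k
              ×-dec ℕP.allUpTo? (λ i → η i ℕ.<? β (suc i)) k

  toPartition : ∀ {β η} → IsPartition β η → Partition I k
  toPartition {β} {η} (β₀ , βₖ , β-incr , η-lo , η-hi) = record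
    { b = β ; y = η ; b-zero = β₀ ; b-last = βₖ
    ; b-incr = λ _ → β-incr ; y-lo = λ _ → η-lo ; y-hi = λ _ → η-hi }

  agreeing-isPartition : ∀ (Q : Partition I k) {β η} →
    EqualBelow (suc k) (b Q) β → EqualBelow k (y Q) η → IsPartition β η
  agreeing-isPartition Q b≗β y≗η =
      trans (sym (b≗β ℕ.z<s)) (b-zero Q)
    , trans (sym (b≗β (ℕP.n<1+n k))) (b-last Q)
    , (λ i<k → subst₂ ℕ._<_ (b≗β (ℕP.m<n⇒m<1+n i<k)) (b≗β (ℕ.s≤s i<k)) (b-incr Q _ i<k))
    , (λ i<k → subst₂ ℕ._≤_ (b≗β (ℕP.m<n⇒m<1+n i<k)) (y≗η i<k) (y-lo Q _ i<k))
    , (λ i<k → subst₂ ℕ._<_ (y≗η i<k) (b≗β (ℕ.s≤s i<k)) (y-hi Q _ i<k))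

  Θk-cong : ∀ (Q Q' : Partition I k) {s} →
    EqualBelow (suc k) (b Q) (b Q') → EqualBelow k (y Q) (y Q') → Θk I k Q s ≡ Θk I k Q' s
  Θk-cong Q Q' {s} b≗b' y≗y' = cong maxℚ (map-cong-local (All.applyUpTo⁺₁ id k λ i<k →
    Θ¹-cong (b≗b' (ℕP.m<n⇒m<1+n i<k)) (cong (_∸ 1) (b≗b' (ℕ.s≤s i<k))) (y≗y' i<k)))
    where
    Θ¹-cong : ∀ {l l' r r' t t'} → l ≡ l' → r ≡ r' → t ≡ t' → Θ¹ I l r t s ≡ Θ¹ I l' r' t' s
    Θ¹-cong refl refl refl = refl

  codes : List ((ℕ → ℕ) × (ℕ → ℕ))
  codes = cartesianProduct (sequencesOver 0 vertices (suc k)) (sequencesOver 0 vertices k)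
    where
    vertices : List ℕ
    vertices = upTo (suc (suc (n I)))

  decode : Partition I k → (ℕ → ℕ) × (ℕ → ℕ) → Partition I k
  decode Q₀ (β , η) with isPartition? β η
  ... | yes β,η-ok = toPartition β,η-ok
  ... | no  _      = Q₀

  decode-isPartition : ∀ Q₀ {β η} → IsPartition β η →
                       b (decode Q₀ (β , η)) ≡ β × y (decode Q₀ (β , η)) ≡ η
  decode-isPartition Q₀ {β} {η} β,η-ok with isPartition? β η
  ... | yes _      = refl , refl
  ... | no  β,η-ko = contradiction β,η-ok β,η-ko

  decodes-cover : ∀ Q₀ s (Q : Partition I k) →
                  ∃ λ Q' → Q' ∈ map (decode Q₀) codes × Θk I k Q' s ≤ Θk I k Q s
  decodes-cover Q₀ s Q
    with sequencesOver-complete 0 _ (suc k) (b Q) (b∈upTo Q ∘ ℕP.m<1+n⇒m≤n)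
       | sequencesOver-complete 0 _ k (y Q) (y∈upTo Q)
  ... | β , β∈ , b≗β | η , η∈ , y≗η =
    decode Q₀ (β , η) , ∈-map⁺ (decode Q₀) (∈-cartesianProduct⁺ β∈ η∈) ,
    ℚP.≤-reflexive (Θk-cong (decode Q₀ (β , η)) Q
      (λ i<1+k → trans (cong-app (proj₁ decoded) _) (sym (b≗β i<1+k)))
      (λ i<k → trans (cong-app (proj₂ decoded) _) (sym (y≗η i<k))))
    where
    decoded : b (decode Q₀ (β , η)) ≡ β × y (decode Q₀ (β , η)) ≡ η
    decoded = decode-isPartition Q₀ (agreeing-isPartition Q b≗β y≗η)

  IsOpt-exists : Partition I k → ∀ s → ∃ (IsOpt I k s)
  IsOpt-exists Q₀ s =
    optimal (minimiser (λ Q → Θk I k Q s) Q₀ (map (decode Q₀) codes) (decodes-cover Q₀ s))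
    where
    optimal : (∃ λ Q* → ∀ Q → Θk I k Q* s ≤ Θk I k Q s) → ∃ (IsOpt I k s)
    optimal (Q* , Q*-minimal) = Θk I k Q* s , (Q* , refl) , Q*-minimal

IsOpt-mono : ∀ {I k} {s s' : Scenario I} {v v'} → (∀ {j} → j ℕ.≤ n I → s j ≤ s' j) →
             IsOpt I k s v → IsOpt I k s' v' → v ≤ v'
IsOpt-mono s≤s' (_ , v-minimal) ((Q' , refl) , _) = ℚP.≤-trans (v-minimal Q') (Θk-mono Q' s≤s')

lemma1 : (I : Instance) (k : ℕ) (P : Partition I k) (s* : Scenario I) (d : ℕ)
         → IsWorstCase I k P s*
         → IsDominant I k P s* d
         → IsWorstCase I k P (restrictTo I P d s*)
lemma1 I k P s* d (s*-scenario , s*-worst) d-dominant@(d<k , _ , _) =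
  restrictTo-isScenario P d s* s*-scenario , regret≤
  where
  s' : Scenario I
  s' = restrictTo I P d s*

  Θk-grows : Θk I k P s* ≤ Θk I k P s'
  Θk-grows = begin
    Θk I k P s*     ≡⟨ Θk≡ΘPart-dominant P d-dominant ⟩
    ΘPart I P d s*  ≤⟨ ΘPart-mono P d<k (ℚP.≤-reflexive ∘ sym ∘ restrictTo-on-part P d s*) ⟩
    ΘPart I P d s'  ≤⟨ ΘPart≤Θk P d<k ⟩
    Θk I k P s'     ∎
    where open ℚP.≤-Reasoning

  regret≤ : ∀ s → IsScenario I s → ∀ v v' → IsOpt I k s v → IsOpt I k s' v' →
            Θk I k P s - v ≤ Θk I k P s' - v'
  regret≤ s s-scenario v v' s-opt s'-opt =
    let v* , s*-opt = IsOpt-exists I k P s*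
        opt-shrinks = IsOpt-mono (restrictTo-≤ P d s* s*-scenario) s'-opt s*-opt
    in ℚP.≤-trans (s*-worst s s-scenario v v* s-opt s*-opt)
                  (ℚP.+-mono-≤ Θk-grows (ℚP.neg-antimono-≤ opt-shrinks))
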